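{- Let $\approx$ be a Substring Consistent Symmetric and Two-Transitive Relation (SCSTTR) on strings over an alphabet $\Sigma$. Let $P$ be a string with $P \approx \overline{P}$, where $\overline{P}$ denotes the reversal of $P$. If $1 \le i \le j \le |P|$ and the substring $P[i..j]$ satisfies $P[i..j] \approx \overline{P[i..j]}$, then the substring $P[|P|-j+1..|P|-i+1]$ satisfies $P[|P|-j+1..|P|-i+1] \approx \overline{P[|P|-j+1..|P|-i+1]}$.
   Context: For a string $T$, $T[i]$ is its $i$-th character, $T[i..j]$ the substring from position $i$ to $j$, and $\overline{T}=T[|T|]\cdots T[1]$ its reversal. An SCSTTR is a relation $\approx$ defined between strings of equal length such that for all strings $W,X,Y,Z\in\Sigma^n$ (for every $n$): (1) symmetry: $X\approx Y$ implies $Y\approx X$; (2) two-transitivity: $W\approx X$, $X\approx Y$ and $Y\approx Z$ imply $W\approx Z$; (3) substring consistency: $X\approx Y$ implies $X[i..j]\approx Y[i..j]$ for all $1\le i\le j\le n$. A string $P$ with $P\approx \overline{P}$ is called an SCSTTR rev-palindrome. -}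

module Defs where

open import Level using (Level; _⊔_) renaming (suc to lsuc)
open import Data.Nat using (ℕ; zero; suc; _+_; _∸_; _≤_; _<_; s≤s; z≤n)
open import Data.Nat.Properties
  using (≤-trans; ≤-reflexive; +-monoʳ-≤; ≤-pred; m+[n∸m]≡n)
open import Data.Fin using (Fin; toℕ; fromℕ<)
open import Data.Fin.Properties using (toℕ<n)
open import Data.Vec using (Vec; lookup; tabulate; reverse)
open import Relation.Binary.PropositionalEquality using (_≡_; cong)

-- Strings of length n over the alphabet Σ are  Vec Σ n.
-- Paper positions are 1-based; Vec positions (Fin n) are 0-based.

private
  bound : (i' j n k : ℕ) → i' < j → j ≤ n → k ≤ j ∸ suc i' → i' + k < n
  bound i' (suc j') n k (s≤s i≤j') j≤n k≤ =
    ≤-trans (s≤s (+-monoʳ-≤ i' k≤)) (≤-trans (≤-reflexive (cong suc (m+[n∸m]≡n i≤j'))) j≤n)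

-- Substring T[i..j] for 1 ≤ i ≤ j ≤ n (1-based, inclusive), of length j - i + 1.
-- Its k-th (0-based) character is T[i+k] (1-based), i.e. Vec index (i-1)+k.
substr : ∀ {a} {Σ : Set a} {n : ℕ} (T : Vec Σ n) (i j : ℕ) →
         1 ≤ i → i ≤ j → j ≤ n → Vec Σ (suc (j ∸ i))
substr T (suc i') j (s≤s z≤n) i≤j j≤n =
  tabulate λ k → lookup T (fromℕ< (bound i' j _ (toℕ k) i≤j j≤n (≤-pred (toℕ<n k))))

record IsSCSTTR {a ℓ} {Σ : Set a} (_≈_ : ∀ {n} → Vec Σ n → Vec Σ n → Set ℓ) : Set (a ⊔ ℓ) where
  field
    symmetric   : ∀ {n} {X Y : Vec Σ n} → X ≈ Y → Y ≈ X
    two-trans   : ∀ {n} {W X Y Z : Vec Σ n} → W ≈ X → X ≈ Y → Y ≈ Z → W ≈ Z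
    substring-consistent :
      ∀ {n} {X Y : Vec Σ n} → X ≈ Y →
      (i j : ℕ) (1≤i : 1 ≤ i) (i≤j : i ≤ j) (j≤n : j ≤ n) →
      substr X i j 1≤i i≤j j≤n ≈ substr Y i j 1≤i i≤j j≤n

RevPal : ∀ {a ℓ} {Σ : Set a} (_≈_ : ∀ {n} → Vec Σ n → Vec Σ n → Set ℓ) {n : ℕ} → Vec Σ n → Set ℓ
RevPal _≈_ P = P ≈ reverse P

mirror-1≤ : (j n : ℕ) → 1 ≤ n ∸ j + 1
mirror-1≤ j n rewrite Data.Nat.Properties.+-comm (n ∸ j) 1 = s≤s z≤n

mirror-≤ : (i j n : ℕ) → i ≤ j → n ∸ j + 1 ≤ n ∸ i + 1
mirror-≤ i j n i≤j = Data.Nat.Properties.+-monoˡ-≤ 1 (Data.Nat.Properties.∸-monoʳ-≤ n i≤j)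

mirror-≤n : (i n : ℕ) → 1 ≤ i → i ≤ n → n ∸ i + 1 ≤ n
mirror-≤n (suc i') (suc n') _ (s≤s i'≤n') =
  ≤-reflexive (Relation.Binary.PropositionalEquality.trans
    (Data.Nat.Properties.+-comm (n' ∸ i') 1)
    (cong suc (Relation.Binary.PropositionalEquality.refl)))
  |> λ p → ≤-trans p (s≤s (Data.Nat.Properties.m∸n≤m n' i'))
  where open import Function using (_|>_)

-- Substring consistency applied to P ≈ reverse P at positions [i..j] and at the mirrored
-- positions [n-j+1..n-i+1] relates each of the two substrings to the reversal of the other,
-- because reading reverse P on [i..j] is reading P backwards on the mirrored interval.
-- Writing Q = P[i..j] and Q' = P[n-j+1..n-i+1], two-transitivity along
-- Q' ≈ reverse Q ≈ Q ≈ reverse Q' then gives the claim.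
module Submission where

open import Defs
open import Level using (Level)
open import Data.Nat using (ℕ; suc; pred; _+_; _∸_; _≤_; _<_; s≤s; z≤n)
open import Data.Nat.Properties
open import Data.Fin using (Fin; toℕ; opposite; inject₁; fromℕ) renaming (zero to fzero; suc to fsuc)
import Data.Fin as Fin
open import Data.Fin.Properties
  using (toℕ-injective; toℕ-fromℕ<; toℕ<n; opposite-prop; opposite-involutive; toℕ-cast)
open import Data.Vec using (Vec; []; _∷_; _∷ʳ_; lookup; tabulate; reverse; cast)
open import Data.Vec.Properties
  using (lookup∘tabulate; tabulate∘lookup; tabulate-cong; reverse-∷; cast-is-id; cast-sym; lookup-cast₁)
open import Data.Product using (∃-syntax; _×_; _,_)
open import Relation.Binary.PropositionalEquality
open ≡-Reasoning

private
  variable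
    a ℓ : Level
    A : Set a
    m n : ℕ

lookup-∷ʳ-inject₁ : (xs : Vec A n) (x : A) (k : Fin n) → lookup (xs ∷ʳ x) (inject₁ k) ≡ lookup xs k
lookup-∷ʳ-inject₁ (y ∷ ys) x fzero    = refl
lookup-∷ʳ-inject₁ (y ∷ ys) x (fsuc k) = lookup-∷ʳ-inject₁ ys x k

lookup-∷ʳ-last : (xs : Vec A n) (x : A) → lookup (xs ∷ʳ x) (fromℕ n) ≡ x
lookup-∷ʳ-last []       x = refl
lookup-∷ʳ-last (y ∷ ys) x = lookup-∷ʳ-last ys x

lookup-reverse-opposite : (xs : Vec A n) (k : Fin n) → lookup (reverse xs) (opposite k) ≡ lookup xs k
lookup-reverse-opposite {n = suc n} (x ∷ xs) fzero = begin
  lookup (reverse (x ∷ xs)) (fromℕ n) ≡⟨ cong (λ v → lookup v (fromℕ n)) (reverse-∷ x xs) ⟩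
  lookup (reverse xs ∷ʳ x) (fromℕ n)  ≡⟨ lookup-∷ʳ-last (reverse xs) x ⟩
  x                                   ∎
lookup-reverse-opposite (x ∷ xs) (fsuc k) = begin
  lookup (reverse (x ∷ xs)) (inject₁ (opposite k)) ≡⟨ cong (λ v → lookup v (inject₁ (opposite k))) (reverse-∷ x xs) ⟩
  lookup (reverse xs ∷ʳ x) (inject₁ (opposite k))  ≡⟨ lookup-∷ʳ-inject₁ (reverse xs) x (opposite k) ⟩
  lookup (reverse xs) (opposite k)                 ≡⟨ lookup-reverse-opposite xs k ⟩
  lookup xs k                                      ∎

lookup-reverse : (xs : Vec A n) (k : Fin n) → lookup (reverse xs) k ≡ lookup xs (opposite k)
lookup-reverse xs k = begin
  lookup (reverse xs) k                       ≡⟨ cong (lookup (reverse xs)) (opposite-involutive k) ⟨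
  lookup (reverse xs) (opposite (opposite k)) ≡⟨ lookup-reverse-opposite xs (opposite k) ⟩
  lookup xs (opposite k)                      ∎

lookup-ext : {xs ys : Vec A n} → (∀ k → lookup xs k ≡ lookup ys k) → xs ≡ ys
lookup-ext {xs = xs} {ys} eq = begin
  xs                   ≡⟨ tabulate∘lookup xs ⟨
  tabulate (lookup xs) ≡⟨ tabulate-cong eq ⟩
  tabulate (lookup ys) ≡⟨ tabulate∘lookup ys ⟩
  ys                   ∎

lookup-substr : (T : Vec A n) (i j : ℕ) (1≤i : 1 ≤ i) (i≤j : i ≤ j) (j≤n : j ≤ n)
                (k : Fin (suc (j ∸ i))) →
                ∃[ f ] toℕ f ≡ pred i + toℕ k × lookup (substr T i j 1≤i i≤j j≤n) k ≡ lookup T f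
lookup-substr {n = n} T (suc i) j (s≤s z≤n) i≤j j≤n k =
  _ , toℕ-fromℕ< _ , lookup∘tabulate (λ k → lookup T (Fin.fromℕ< (i+k<n k))) k
  where
  i+k<n : (k : Fin (suc (j ∸ suc i))) → i + toℕ k < n
  i+k<n k = ≤-trans (s≤s (+-monoʳ-≤ i (≤-pred (toℕ<n k)))) (≤-trans (≤-reflexive (m+[n∸m]≡n i≤j)) j≤n)

m+[n∸m+1]≡1+n : m ≤ n → m + (n ∸ m + 1) ≡ suc n
m+[n∸m+1]≡1+n {m} {n} m≤n = begin
  m + (n ∸ m + 1) ≡⟨ +-assoc m (n ∸ m) 1 ⟨
  m + (n ∸ m) + 1 ≡⟨ cong (_+ 1) (m+[n∸m]≡n m≤n) ⟩
  n + 1           ≡⟨ +-comm n 1 ⟩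
  suc n           ∎

-- Two intervals [i..j] and [i₂..j₂] of 1..n are mirror images of each other exactly when
-- i + j₂ ≡ 1 + n and i₂ + j ≡ 1 + n.
mirror-length : ∀ {n} i j i₂ j₂ → i + j₂ ≡ suc n → i₂ + j ≡ suc n → j ∸ i ≡ j₂ ∸ i₂
mirror-length i j i₂ j₂ i+j₂≡ i₂+j≡ = begin
  j ∸ i               ≡⟨ [m+n]∸[m+o]≡n∸o i₂ j i ⟨
  (i₂ + j) ∸ (i₂ + i) ≡⟨ cong₂ _∸_ (trans i₂+j≡ (sym i+j₂≡)) (+-comm i₂ i) ⟩
  (i + j₂) ∸ (i + i₂) ≡⟨ [m+n]∸[m+o]≡n∸o i j₂ i₂ ⟩
  j₂ ∸ i₂             ∎

mirror-position : ∀ {n i i₂ j₂ k} → i + j₂ ≡ suc n → 1 ≤ i → 1 ≤ i₂ → i₂ + k ≤ j₂ →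
                  n ∸ suc (pred i + k) ≡ pred i₂ + (j₂ ∸ i₂ ∸ k)
mirror-position {n} {suc i} {suc i₂} {j₂} {k} i+j₂≡ _ _ i₂+k≤j₂ = begin
  n ∸ suc (i + k)          ≡⟨ cong (_∸ suc (i + k)) (suc-injective i+j₂≡) ⟨
  (i + j₂) ∸ suc (i + k)   ≡⟨ cong ((i + j₂) ∸_) (+-suc i k) ⟨
  (i + j₂) ∸ (i + suc k)   ≡⟨ [m+n]∸[m+o]≡n∸o i j₂ (suc k) ⟩
  j₂ ∸ suc k               ≡⟨ [m+n]∸[m+o]≡n∸o i₂ j₂ (suc k) ⟨
  (i₂ + j₂) ∸ (i₂ + suc k) ≡⟨ cong ((i₂ + j₂) ∸_) (+-suc i₂ k) ⟩
  (i₂ + j₂) ∸ suc (i₂ + k) ≡⟨ +-∸-assoc i₂ i₂+k≤j₂ ⟩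
  i₂ + (j₂ ∸ suc (i₂ + k)) ≡⟨ cong (i₂ +_) (∸-+-assoc j₂ (suc i₂) k) ⟨
  i₂ + (j₂ ∸ suc i₂ ∸ k)   ∎

substr-reverse : (P : Vec A n) (i j i₂ j₂ : ℕ)
                 (1≤i : 1 ≤ i) (i≤j : i ≤ j) (j≤n : j ≤ n)
                 (1≤i₂ : 1 ≤ i₂) (i₂≤j₂ : i₂ ≤ j₂) (j₂≤n : j₂ ≤ n)
                 (i+j₂≡1+n : i + j₂ ≡ suc n) (i₂+j≡1+n : i₂ + j ≡ suc n) →
                 cast (cong suc (mirror-length i j i₂ j₂ i+j₂≡1+n i₂+j≡1+n)) (substr (reverse P) i j 1≤i i≤j j≤n)
                   ≡ reverse (substr P i₂ j₂ 1≤i₂ i₂≤j₂ j₂≤n)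
substr-reverse {n = n} P i j i₂ j₂ 1≤i i≤j j≤n 1≤i₂ i₂≤j₂ j₂≤n i+j₂≡1+n i₂+j≡1+n =
  lookup-ext pointwise
  where
  e : suc (j ∸ i) ≡ suc (j₂ ∸ i₂)
  e = cong suc (mirror-length i j i₂ j₂ i+j₂≡1+n i₂+j≡1+n)
  R : Vec _ (suc (j ∸ i))
  R = substr (reverse P) i j 1≤i i≤j j≤n
  Q : Vec _ (suc (j₂ ∸ i₂))
  Q = substr P i₂ j₂ 1≤i₂ i₂≤j₂ j₂≤n

  pointwise : (k : Fin (suc (j₂ ∸ i₂))) → lookup (cast e R) k ≡ lookup (reverse Q) k
  pointwise k with lookup-substr (reverse P) i j 1≤i i≤j j≤n (Fin.cast (sym e) k)
                 | lookup-substr P i₂ j₂ 1≤i₂ i₂≤j₂ j₂≤n (opposite k)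
  ... | f , f≡ , R[k]≡ | g , g≡ , Q[k̄]≡ = begin
    lookup (cast e R) k           ≡⟨ lookup-cast₁ e R k ⟩
    lookup R (Fin.cast (sym e) k) ≡⟨ R[k]≡ ⟩
    lookup (reverse P) f          ≡⟨ lookup-reverse P f ⟩
    lookup P (opposite f)         ≡⟨ cong (lookup P) (toℕ-injective opposite-f≡g) ⟩
    lookup P g                    ≡⟨ Q[k̄]≡ ⟨
    lookup Q (opposite k)         ≡⟨ lookup-reverse Q k ⟨
    lookup (reverse Q) k          ∎
    where
    i₂+k≤j₂ : i₂ + toℕ k ≤ j₂
    i₂+k≤j₂ = ≤-trans (+-monoʳ-≤ i₂ (≤-pred (toℕ<n k))) (≤-reflexive (m+[n∸m]≡n i₂≤j₂))

    opposite-f≡g : toℕ (opposite f) ≡ toℕ g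
    opposite-f≡g = begin
      toℕ (opposite f)                 ≡⟨ opposite-prop f ⟩
      n ∸ suc (toℕ f)                  ≡⟨ cong (λ x → n ∸ suc x) (trans f≡ (cong (pred i +_) (toℕ-cast (sym e) k))) ⟩
      n ∸ suc (pred i + toℕ k)         ≡⟨ mirror-position i+j₂≡1+n 1≤i 1≤i₂ i₂+k≤j₂ ⟩
      pred i₂ + (j₂ ∸ i₂ ∸ toℕ k)      ≡⟨ cong (pred i₂ +_) (opposite-prop k) ⟨
      pred i₂ + toℕ (opposite k)       ≡⟨ g≡ ⟨
      toℕ g                            ∎

cast-resp : (_≈_ : ∀ {n} → Vec A n → Vec A n → Set ℓ) (e : m ≡ n) {X Y : Vec A m} →
            X ≈ Y → cast e X ≈ cast e Y
cast-resp _≈_ refl {X} {Y} X≈Y rewrite cast-is-id refl X | cast-is-id refl Y = X≈Y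

mainTheorem1 : ∀ {a ℓ} {Σ : Set a} (_≈_ : ∀ {n} → Vec Σ n → Vec Σ n → Set ℓ) →
    IsSCSTTR _≈_ →
    ∀ {n} (P : Vec Σ n) → P ≈ reverse P →
    (i j : ℕ) (1≤i : 1 ≤ i) (i≤j : i ≤ j) (j≤n : j ≤ n) →
    substr P i j 1≤i i≤j j≤n ≈ reverse (substr P i j 1≤i i≤j j≤n) →
    substr P (n ∸ j + 1) (n ∸ i + 1)
        (mirror-1≤ j n) (mirror-≤ i j n i≤j) (mirror-≤n i n 1≤i (≤-trans i≤j j≤n))
      ≈ reverse (substr P (n ∸ j + 1) (n ∸ i + 1)
        (mirror-1≤ j n) (mirror-≤ i j n i≤j) (mirror-≤n i n 1≤i (≤-trans i≤j j≤n)))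
mainTheorem1 _≈_ S {n} P P≈P̄ i j 1≤i i≤j j≤n Q≈Q̄ =
  two-trans Q'≈cast-Q̄ (cast-resp _≈_ e (symmetric Q≈Q̄)) cast-Q≈Q̄'
  where
  open IsSCSTTR S
  i' j' : ℕ
  i' = n ∸ j + 1
  j' = n ∸ i + 1
  1≤i' : 1 ≤ i'
  1≤i' = mirror-1≤ j n
  i'≤j' : i' ≤ j'
  i'≤j' = mirror-≤ i j n i≤j
  j'≤n : j' ≤ n
  j'≤n = mirror-≤n i n 1≤i (≤-trans i≤j j≤n)

  i+j'≡1+n : i + j' ≡ suc n
  i+j'≡1+n = m+[n∸m+1]≡1+n (≤-trans i≤j j≤n)
  i'+j≡1+n : i' + j ≡ suc n
  i'+j≡1+n = trans (+-comm i' j) (m+[n∸m+1]≡1+n j≤n)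

  e : suc (j ∸ i) ≡ suc (j' ∸ i')
  e = cong suc (mirror-length i j i' j' i+j'≡1+n i'+j≡1+n)

  Q Q' : Vec _ _
  Q = substr P i j 1≤i i≤j j≤n
  Q' = substr P i' j' 1≤i' i'≤j' j'≤n

  Q'≈cast-Q̄ : Q' ≈ cast e (reverse Q)
  Q'≈cast-Q̄ = subst (Q' ≈_)
    (sym (cast-sym _ (substr-reverse P i' j' i j 1≤i' i'≤j' j'≤n 1≤i i≤j j≤n i'+j≡1+n i+j'≡1+n)))
    (substring-consistent P≈P̄ i' j' 1≤i' i'≤j' j'≤n)
  cast-Q≈Q̄' : cast e Q ≈ reverse Q'
  cast-Q≈Q̄' = subst (cast e Q ≈_)
    (substr-reverse P i j i' j' 1≤i i≤j j≤n 1≤i' i'≤j' j'≤n i+j'≡1+n i'+j≡1+n)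
    (cast-resp _≈_ e (substring-consistent P≈P̄ i j 1≤i i≤j j≤n))
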